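{- The monoid $\mathrm{Styl}(A)$ has a zero element, namely the image under $\mu$ of the strictly decreasing product of all the letters of $A$.
   Context: $A$ is a finite totally ordered alphabet. A column is a subset of $A$, identified with the strictly decreasing word of its elements. For a column $\gamma$ and a letter $x$: if $x>y$ for all $y\in\gamma$, $x\cdot\gamma=\gamma\cup\{x\}$; otherwise with $y$ the smallest element of $\gamma$ with $y\geq x$, $x\cdot\gamma=(\gamma\setminus\{y\})\cup\{x\}$; this extends to a left action of $A^*$ on columns by $(uv)\cdot\gamma=u\cdot(v\cdot\gamma)$. $\mathrm{Styl}(A)$ is the monoid of maps on columns induced by words, and $\mu:A^*\to\mathrm{Styl}(A)$ the canonical surjection. -}

module Defs where

open import Data.Nat using (ℕ; zero; suc)
open import Data.Fin using (Fin; zero; suc)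
open import Data.Bool using (Bool; true; false)
open import Data.Vec using (Vec; []; _∷_; _[_]≔_)
open import Data.List using (List; []; _∷_; reverse; allFin)
open import Data.Product using (_×_)
open import Function using (_∘_)
open import Relation.Binary.PropositionalEquality using (_≗_)

-- The alphabet A is Fin n with its standard total order (zero < suc zero < ...).
-- A column is a subset of A, encoded as a characteristic vector.
Column : ℕ → Set
Column n = Vec Bool n

Word : ℕ → Set
Word n = List (Fin n)

rmFirst : ∀ {n} → Column n → Column n
rmFirst []          = []
rmFirst (true ∷ v)  = false ∷ v
rmFirst (false ∷ v) = false ∷ rmFirst v

rmFrom : ∀ {n} → Fin n → Column n → Column n
rmFrom zero    (true ∷ v)  = false ∷ v
rmFrom zero    (false ∷ v) = false ∷ rmFirst v
rmFrom (suc i) (b ∷ v)     = b ∷ rmFrom i v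

-- x · γ : if no y ∈ γ with y ≥ x, add x; otherwise replace the smallest
-- such y by x.
_·_ : ∀ {n} → Fin n → Column n → Column n
x · γ = rmFrom x γ [ x ]≔ true

-- left action of words: (u v)·γ = u·(v·γ); this is the map μ(w).
μ : ∀ {n} → Word n → Column n → Column n
μ []      γ = γ
μ (x ∷ w) γ = x · μ w γ

decreasingAll : ∀ n → Word n
decreasingAll n = reverse (allFin n)

-- An element f of Styl(A) (a map on columns, equality = equality of maps)
-- is a zero of the monoid Styl(A) = { μ w | w ∈ A* } under composition.
IsZero : ∀ {n} → (Column n → Column n) → Set
IsZero {n} f = ∀ (w : Word n) → ((μ w ∘ f) ≗ f) × ((f ∘ μ w) ≗ f)

-- Reading the decreasing word of all letters from the right, the letters act in increasing
-- order; letter i only removes an element y ≥ i and then inserts i, so it never disturbs the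
-- letters inserted before it. Hence μ of that word is the constant map onto the full column A.
-- The full column is fixed by every letter (x removes and reinserts x itself), and a constant
-- map whose value is fixed by every μ w absorbs all of Styl(A) on both sides.
module Submission where

open import Defs
open import Data.Nat using (ℕ; zero; suc)
open import Data.Fin using (Fin; zero; suc)
open import Data.Bool using (true; false)
open import Data.Vec using (_∷_; replicate; tail)
import Data.Vec as Vec
open import Data.List using ([]; _∷_; _++_; map; reverse; allFin; tabulate; [_])
open import Data.List.Properties using (unfold-reverse; reverse-map; map-tabulate)
open import Data.Product using (_,_)
open import Function using (id)
open import Relation.Binary.PropositionalEquality
  using (_≡_; refl; sym; trans; cong; module ≡-Reasoning)

fullColumn : ∀ n → Column n
fullColumn n = replicate n true

·-fullColumn : ∀ {n} (x : Fin n) → x · fullColumn n ≡ fullColumn n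
·-fullColumn zero    = refl
·-fullColumn (suc x) = cong (true ∷_) (·-fullColumn x)

μ-fullColumn : ∀ {n} (w : Word n) → μ w (fullColumn n) ≡ fullColumn n
μ-fullColumn []      = refl
μ-fullColumn (x ∷ w) = trans (cong (x ·_) (μ-fullColumn w)) (·-fullColumn x)

constant-fixed⇒IsZero : ∀ {n} (f : Column n → Column n) (c : Column n) →
                        (∀ γ → f γ ≡ c) → (∀ w → μ w c ≡ c) → IsZero f
constant-fixed⇒IsZero f c f≡c fixed w =
    (λ γ → trans (cong (μ w) (f≡c γ)) (trans (fixed w) (sym (f≡c γ))))
  , (λ γ → trans (f≡c (μ w γ)) (sym (f≡c γ)))

μ-++ : ∀ {n} (u v : Word n) γ → μ (u ++ v) γ ≡ μ u (μ v γ)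
μ-++ []      v γ = refl
μ-++ (x ∷ u) v γ = cong (x ·_) (μ-++ u v γ)

μ-map-suc : ∀ {n} (w : Word n) b γ → μ (map suc w) (b ∷ γ) ≡ b ∷ μ w γ
μ-map-suc []      b γ = refl
μ-map-suc (x ∷ w) b γ = cong (suc x ·_) (μ-map-suc w b γ)

zero·-head : ∀ {n} (γ : Column (suc n)) → zero · γ ≡ true ∷ tail (zero · γ)
zero·-head (true  ∷ γ) = refl
zero·-head (false ∷ γ) = refl

decreasingAll-suc : ∀ n → decreasingAll (suc n) ≡ map suc (decreasingAll n) ++ [ zero ]
decreasingAll-suc n = begin
  reverse (zero ∷ tabulate suc)            ≡⟨ unfold-reverse zero (tabulate suc) ⟩
  reverse (tabulate suc) ++ [ zero ]       ≡⟨ cong (λ l → reverse l ++ [ zero ]) (sym (map-tabulate id suc)) ⟩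
  reverse (map suc (allFin n)) ++ [ zero ] ≡⟨ cong (_++ [ zero ]) (sym (reverse-map suc (allFin n))) ⟩
  map suc (decreasingAll n) ++ [ zero ]    ∎
  where open ≡-Reasoning

μ-decreasingAll : ∀ n (γ : Column n) → μ (decreasingAll n) γ ≡ fullColumn n
μ-decreasingAll zero    Vec.[] = refl
μ-decreasingAll (suc n) γ  = begin
  μ (decreasingAll (suc n)) γ                            ≡⟨ cong (λ w → μ w γ) (decreasingAll-suc n) ⟩
  μ (map suc (decreasingAll n) ++ [ zero ]) γ            ≡⟨ μ-++ (map suc (decreasingAll n)) [ zero ] γ ⟩
  μ (map suc (decreasingAll n)) (zero · γ)               ≡⟨ cong (μ (map suc (decreasingAll n))) (zero·-head γ) ⟩
  μ (map suc (decreasingAll n)) (true ∷ tail (zero · γ)) ≡⟨ μ-map-suc (decreasingAll n) true (tail (zero · γ)) ⟩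
  true ∷ μ (decreasingAll n) (tail (zero · γ))           ≡⟨ cong (true ∷_) (μ-decreasingAll n (tail (zero · γ))) ⟩
  fullColumn (suc n)                                     ∎
  where open ≡-Reasoning

proposition5p4 : (n : ℕ) → IsZero (μ (decreasingAll n))
proposition5p4 n =
  constant-fixed⇒IsZero (μ (decreasingAll n)) (fullColumn n) (μ-decreasingAll n) μ-fullColumn
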